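{- For $n\ge 1$ let $g_{n,i}$ denote the $i$th entry of the $g$-vector of $[n]!$ for $0\le i\le\lfloor\binom n2/2\rfloor$, and set $g_{n,i}=0$ for all other integers $i$. Then for every $n\ge 2$ and every integer $i$, $$g_{n,i}=\begin{cases}\displaystyle\sum_{j=i-(n-1)}^{i}g_{n-1,j} & \text{if } i\le\left\lceil\binom{n-1}{2}/2\right\rceil,\\[2ex] \displaystyle\sum_{j=i-(n-1)}^{\binom n2-i-(n-1)}g_{n-1,j} & \text{if } i>\left\lceil\binom{n-1}{2}/2\right\rceil.\end{cases}$$
   Context: $[m]=1+q+\cdots+q^{m-1}$, $[n]!=[n][n-1]\cdots[1]$, a palindromic polynomial of palindromic degree $d=\binom n2$. Its $g$-vector $(g_0,\dots,g_{\lfloor d/2\rfloor})$ is defined by $[n]!=\sum_{0\le 2i\le d}g_i(q^i+q^{i+1}+\cdots+q^{d-i})$, equivalently $g_i$ is the coefficient of $q^i$ minus the coefficient of $q^{i-1}$ in $[n]!$. A sum whose upper limit is smaller than its lower limit is zero. -}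

module Defs where

open import Data.Nat as ℕ using (ℕ; zero; suc)
open import Data.Nat.Combinatorics using (_C_)
open import Data.List using (List; []; _∷_; replicate)
open import Data.Integer as ℤ using (ℤ; +_; -[1+_]; _-_; _≤_; _<_; _⊔_; ∣_∣)
open import Data.Bool using (if_then_else_)
open import Relation.Nullary.Decidable using (⌊_⌋)

-- Polynomials with natural-number coefficients, as coefficient lists
-- (constant term first).
Poly : Set
Poly = List ℕ

_+ₚ_ : Poly → Poly → Poly
[] +ₚ q = q
(a ∷ p) +ₚ [] = a ∷ p
(a ∷ p) +ₚ (b ∷ q) = (a ℕ.+ b) ∷ (p +ₚ q)

scale : ℕ → Poly → Poly
scale c [] = []
scale c (a ∷ p) = (c ℕ.* a) ∷ scale c p

_*ₚ_ : Poly → Poly → Poly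
[] *ₚ q = []
(a ∷ p) *ₚ q = scale a q +ₚ (0 ∷ (p *ₚ q))

coeff : Poly → ℕ → ℕ
coeff [] k = 0
coeff (a ∷ p) zero = a
coeff (a ∷ p) (suc k) = coeff p k

qint : ℕ → Poly
qint m = replicate m 1

qfact : ℕ → Poly
qfact zero = 1 ∷ []
qfact (suc n) = qint (suc n) *ₚ qfact n

coeffℤ : Poly → ℤ → ℤ
coeffℤ p (+ k) = + coeff p k
coeffℤ p -[1+ k ] = + 0

pdeg : ℕ → ℕ
pdeg n = n C 2

g : ℕ → ℤ → ℤ
g n i =
  if ⌊ + 0 ℤ.≤? i ⌋ Data.Bool.∧ ⌊ i ℤ.≤? + (pdeg n ℕ./ 2) ⌋
  then coeffℤ (qfact n) i - coeffℤ (qfact n) (i - + 1)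
  else + 0
  where import Data.Bool

-- Σ_{j=a}^{b} f j over integers; zero when b < a.
sumFromLen : ℤ → ℕ → (ℤ → ℤ) → ℤ
sumFromLen a zero f = + 0
sumFromLen a (suc k) f = f a ℤ.+ sumFromLen (a ℤ.+ + 1) k f

sumRange : ℤ → ℤ → (ℤ → ℤ) → ℤ
sumRange a b f = sumFromLen a ∣ (b ℤ.+ + 1 - a) ⊔ + 0 ∣ f

-- Write A n j for the coefficient of q^j in [n]! (zero for negative j),
-- d = binom(n,2) for its degree, and Δ F j = F j - F (j - 1) for the
-- backward difference.  By definition g n j = Δ (A n) j for j ≤ ⌊d/2⌋.
-- The proof rests on three facts about [n]!:
--   * multiplying by [m] = 1 + q + ... + q^(m-1) acts on differences by
--     Δ([m] P) j = P j - P (j - m), so Δ (A (m+1)) i = A m i - A m (i-m-1);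
--   * [n]! is palindromic of degree d (proved by induction on n: a
--     function is determined by its differences and its values at negative
--     exponents);
--   * by palindromy, g n j = Δ (A n) j even up to ⌈d/2⌉.
-- Hence the sum of g (n-1) over [a, b] telescopes to A (n-1) b - A (n-1) (a-1)
-- whenever b ≤ ⌈binom(n-1,2)/2⌉.  For i ≤ ⌈binom(n-1,2)/2⌉ this gives the
-- first formula directly; for larger i the upper limit binom(n,2) - i - (n-1)
-- equals binom(n-1,2) - i, and palindromy turns A (n-1) (binom(n-1,2) - i)
-- back into A (n-1) i, unless i > ⌊binom(n,2)/2⌋, where both sides vanish.
module Submission where

open import Defs
open import Data.Nat using (ℕ; _≥_; _∸_; _/_)
open import Data.Integer using (ℤ; +_; _-_; _≤_; _>_)
open import Data.Product using (_×_)
open import Relation.Binary.PropositionalEquality using (_≡_)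

import Data.Nat as ℕ
import Data.Nat.Properties as ℕP
import Data.Nat.DivMod as ℕD
open import Data.Nat.Combinatorics using (_C_; nCk+nC[k+1]≡[n+1]C[k+1]; nC1≡n)
open import Data.Integer using (-[1+_]; _+_; -_; _<_; _⊔_; ∣_∣; +≤+; +<+; _≤?_)
import Data.Integer.Properties as ℤP
open import Data.Integer.Tactic.RingSolver using (solve-∀)
open import Data.List using ([]; _∷_)
open import Data.Product using (_,_)
open import Data.Bool using (if_then_else_; _∧_)
open import Relation.Nullary using (Dec; yes; no; ¬_; contradiction)
open import Relation.Nullary.Decidable using (⌊_⌋)
open import Relation.Binary.PropositionalEquality
  using (refl; sym; trans; cong; cong₂; subst; module ≡-Reasoning)

open ≡-Reasoning

Δ : (ℤ → ℤ) → ℤ → ℤ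
Δ F j = F j - F (j - + 1)

VanishesFrom : (ℤ → ℤ) → ℕ → Set
VanishesFrom F e = ∀ j → + e ≤ j → F j ≡ + 0

Palindromic : (ℤ → ℤ) → ℕ → Set
Palindromic F d = ∀ j → F (+ d - j) ≡ F j

coeff-+ₚ : ∀ p q k → coeff (p +ₚ q) k ≡ coeff p k ℕ.+ coeff q k
coeff-+ₚ [] q k = refl
coeff-+ₚ (a ∷ p) [] k = sym (ℕP.+-identityʳ _)
coeff-+ₚ (a ∷ p) (b ∷ q) ℕ.zero = refl
coeff-+ₚ (a ∷ p) (b ∷ q) (ℕ.suc k) = coeff-+ₚ p q k

coeff-scale : ∀ c p k → coeff (scale c p) k ≡ c ℕ.* coeff p k
coeff-scale c [] k = sym (ℕP.*-zeroʳ c)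
coeff-scale c (a ∷ p) ℕ.zero = refl
coeff-scale c (a ∷ p) (ℕ.suc k) = coeff-scale c p k

coeffℤ-+ₚ : ∀ p q j → coeffℤ (p +ₚ q) j ≡ coeffℤ p j + coeffℤ q j
coeffℤ-+ₚ p q (+ k) = cong +_ (coeff-+ₚ p q k)
coeffℤ-+ₚ p q -[1+ k ] = refl

coeffℤ-scale-1 : ∀ p j → coeffℤ (scale 1 p) j ≡ coeffℤ p j
coeffℤ-scale-1 p (+ k) = cong +_ (trans (coeff-scale 1 p k) (ℕP.*-identityˡ _))
coeffℤ-scale-1 p -[1+ k ] = refl

coeffℤ-shift : ∀ p j → coeffℤ (0 ∷ p) j ≡ coeffℤ p (j - + 1)
coeffℤ-shift p (+ ℕ.zero) = refl
coeffℤ-shift p (+ ℕ.suc k) = refl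
coeffℤ-shift p -[1+ k ] = refl

coeffℤ-[] : ∀ j → coeffℤ [] j ≡ + 0
coeffℤ-[] (+ k) = refl
coeffℤ-[] -[1+ k ] = refl

coeffℤ-qint-suc : ∀ m P j →
  coeffℤ (qint (ℕ.suc m) *ₚ P) j ≡ coeffℤ P j + coeffℤ (qint m *ₚ P) (j - + 1)
coeffℤ-qint-suc m P j = begin
  coeffℤ (scale 1 P +ₚ (0 ∷ (qint m *ₚ P))) j
    ≡⟨ coeffℤ-+ₚ (scale 1 P) _ j ⟩
  coeffℤ (scale 1 P) j + coeffℤ (0 ∷ (qint m *ₚ P)) j
    ≡⟨ cong₂ _+_ (coeffℤ-scale-1 P j) (coeffℤ-shift _ j) ⟩
  coeffℤ P j + coeffℤ (qint m *ₚ P) (j - + 1) ∎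

-- (1 - q)[m] = 1 - q^m, read on coefficients: Δ([m] P) j = P j - P (j - m).
Δ-qint : ∀ m P j → Δ (coeffℤ (qint m *ₚ P)) j ≡ coeffℤ P j - coeffℤ P (j - + m)
Δ-qint ℕ.zero P j = begin
  coeffℤ [] j - coeffℤ [] (j - + 1)  ≡⟨ cong₂ _-_ (coeffℤ-[] j) (coeffℤ-[] (j - + 1)) ⟩
  + 0                                ≡⟨ sym (ℤP.+-inverseʳ (coeffℤ P j)) ⟩
  coeffℤ P j - coeffℤ P j            ≡⟨ cong (λ x → coeffℤ P j - coeffℤ P x) (sym (ℤP.+-identityʳ j)) ⟩
  coeffℤ P j - coeffℤ P (j - + 0)    ∎
Δ-qint (ℕ.suc m) P j = begin
  Δ Q' j
    ≡⟨ cong₂ _-_ (coeffℤ-qint-suc m P j) (coeffℤ-qint-suc m P (j - + 1)) ⟩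
  (F j + Q (j - + 1)) - (F (j - + 1) + Q (j - + 1 - + 1))
    ≡⟨ regroup (F j) (F (j - + 1)) (Q (j - + 1)) (Q (j - + 1 - + 1)) ⟩
  Δ F j + Δ Q (j - + 1)
    ≡⟨ cong (λ x → Δ F j + x) (Δ-qint m P (j - + 1)) ⟩
  (F j - F (j - + 1)) + (F (j - + 1) - F (j - + 1 - + m))
    ≡⟨ telescope₂ (F j) (F (j - + 1)) (F (j - + 1 - + m)) ⟩
  F j - F (j - + 1 - + m)
    ≡⟨ cong (λ x → F j - F x) (shift j (+ m)) ⟩
  F j - F (j - + ℕ.suc m) ∎
  where
  F = coeffℤ P
  Q = coeffℤ (qint m *ₚ P)
  Q' = coeffℤ (qint (ℕ.suc m) *ₚ P)
  regroup : ∀ a b c e → (a + c) - (b + e) ≡ (a - b) + (c - e)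
  regroup = solve-∀
  telescope₂ : ∀ a b c → (a - b) + (b - c) ≡ a - c
  telescope₂ = solve-∀
  shift : ∀ x y → x - + 1 - y ≡ x - (+ 1 + y)
  shift = solve-∀

vanishes-qint : ∀ d P → VanishesFrom (coeffℤ P) (ℕ.suc d) →
  ∀ m → VanishesFrom (coeffℤ (qint m *ₚ P)) (d ℕ.+ m)
vanishes-qint d P P-vanishes ℕ.zero j _ = coeffℤ-[] j
vanishes-qint d P P-vanishes (ℕ.suc m) (+ ℕ.suc k) (+≤+ d+m<k) = begin
  coeffℤ (qint (ℕ.suc m) *ₚ P) (+ ℕ.suc k)  ≡⟨ coeffℤ-qint-suc m P (+ ℕ.suc k) ⟩
  coeffℤ P (+ ℕ.suc k) + coeffℤ (qint m *ₚ P) (+ k)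
    ≡⟨ cong₂ _+_ (P-vanishes _ (+≤+ (ℕ.s≤s (ℕP.≤-trans (ℕP.m≤m+n d m) d+m≤k))))
                 (vanishes-qint d P P-vanishes m (+ k) (+≤+ d+m≤k)) ⟩
  + 0 ∎
  where
  d+m≤k : d ℕ.+ m ℕ.≤ k
  d+m≤k = ℕP.≤-pred (subst (ℕ._≤ ℕ.suc k) (ℕP.+-suc d m) d+m<k)
vanishes-qint d P P-vanishes (ℕ.suc m) (+ ℕ.zero) (+≤+ d+m<0) =
  contradiction (subst (ℕ._≤ 0) (ℕP.+-suc d m) d+m<0) λ ()

agree-by-differences : (f h : ℤ → ℤ) →
  (∀ k → f -[1+ k ] ≡ h -[1+ k ]) → (∀ k → Δ f (+ k) ≡ Δ h (+ k)) →
  ∀ j → f j ≡ h j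
agree-by-differences f h negative difference = agree
  where
  recover : ∀ (F : ℤ → ℤ) j → F j ≡ Δ F j + F (j - + 1)
  recover F j = undo (F j) (F (j - + 1))
    where
    undo : ∀ x y → x ≡ (x - y) + y
    undo = solve-∀
  agree : ∀ j → f j ≡ h j
  agree -[1+ k ] = negative k
  agree (+ k) = begin
    f (+ k)                       ≡⟨ recover f (+ k) ⟩
    Δ f (+ k) + f (+ k - + 1)     ≡⟨ cong₂ _+_ (difference k) (previous k) ⟩
    Δ h (+ k) + h (+ k - + 1)     ≡⟨ sym (recover h (+ k)) ⟩
    h (+ k) ∎
    where
    previous : ∀ k → f (+ k - + 1) ≡ h (+ k - + 1)
    previous ℕ.zero = negative 0
    previous (ℕ.suc k) = agree (+ k)

Δ-reflect : ∀ (F : ℤ → ℤ) c j → Δ (λ x → F (c - x)) j ≡ - Δ F (c - (j - + 1))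
Δ-reflect F c j = begin
  F (c - j) - F (c - (j - + 1))
    ≡⟨ cong (λ x → F x - F (c - (j - + 1))) (step c j) ⟩
  F (c - (j - + 1) - + 1) - F (c - (j - + 1))
    ≡⟨ swap (F (c - (j - + 1) - + 1)) (F (c - (j - + 1))) ⟩
  - Δ F (c - (j - + 1)) ∎
  where
  step : ∀ c j → c - j ≡ c - (j - + 1) - + 1
  step = solve-∀
  swap : ∀ x y → x - y ≡ - (y - x)
  swap = solve-∀

palindromic-qint : ∀ d m P → VanishesFrom (coeffℤ P) (ℕ.suc d) → Palindromic (coeffℤ P) d →
  Palindromic (coeffℤ (qint (ℕ.suc m) *ₚ P)) (d ℕ.+ m)
palindromic-qint d m P P-vanishes P-palindromic =
  agree-by-differences (λ x → G (c - x)) G reflected-negative same-differences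
  where
  F = coeffℤ P
  G = coeffℤ (qint (ℕ.suc m) *ₚ P)
  c = + (d ℕ.+ m)
  reflected-negative : ∀ k → G (c - -[1+ k ]) ≡ + 0
  reflected-negative k = vanishes-qint d P P-vanishes (ℕ.suc m) _
    (+≤+ (ℕP.≤-trans (ℕP.≤-reflexive (ℕP.+-suc d m)) (ℕP.m<m+n (d ℕ.+ m) (ℕ.s≤s ℕ.z≤n))))
  index₁ : ∀ d m j → (d + m) - (j - + 1) - (+ 1 + m) ≡ d - j
  index₁ = solve-∀
  index₂ : ∀ d m j → (d + m) - (j - + 1) ≡ d - (j - (+ 1 + m))
  index₂ = solve-∀
  swap : ∀ x y → - (x - y) ≡ y - x
  swap = solve-∀
  same-differences : ∀ k → Δ (λ x → G (c - x)) (+ k) ≡ Δ G (+ k)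
  same-differences k = begin
    Δ (λ x → G (c - x)) j                         ≡⟨ Δ-reflect G c j ⟩
    - Δ G x                                       ≡⟨ cong -_ (Δ-qint (ℕ.suc m) P x) ⟩
    - (F x - F (x - + ℕ.suc m))                   ≡⟨ swap (F x) (F (x - + ℕ.suc m)) ⟩
    F (x - + ℕ.suc m) - F x
      ≡⟨ cong₂ (λ y z → F y - F z) (index₁ (+ d) (+ m) j) (index₂ (+ d) (+ m) j) ⟩
    F (+ d - j) - F (+ d - (j - + ℕ.suc m))
      ≡⟨ cong₂ _-_ (P-palindromic j) (P-palindromic (j - + ℕ.suc m)) ⟩
    F j - F (j - + ℕ.suc m)                       ≡⟨ sym (Δ-qint (ℕ.suc m) P j) ⟩
    Δ G j ∎
    where
    j = + k
    x = c - (j - + 1)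

A : ℕ → ℤ → ℤ
A n = coeffℤ (qfact n)

pdeg-suc : ∀ n → pdeg (ℕ.suc n) ≡ pdeg n ℕ.+ n
pdeg-suc n = begin
  ℕ.suc n C 2          ≡⟨ sym (nCk+nC[k+1]≡[n+1]C[k+1] n 1) ⟩
  n C 1 ℕ.+ n C 2      ≡⟨ cong (ℕ._+ n C 2) (nC1≡n n) ⟩
  n ℕ.+ n C 2          ≡⟨ ℕP.+-comm n _ ⟩
  n C 2 ℕ.+ n ∎

vanishes-qfact : ∀ n → VanishesFrom (A n) (ℕ.suc (pdeg n))
vanishes-qfact ℕ.zero (+ ℕ.suc k) _ = refl
vanishes-qfact ℕ.zero (+ ℕ.zero) (+≤+ ())
vanishes-qfact (ℕ.suc n) =
  subst (VanishesFrom (A (ℕ.suc n)))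
        (trans (ℕP.+-suc (pdeg n) n) (cong ℕ.suc (sym (pdeg-suc n))))
        (vanishes-qint (pdeg n) (qfact n) (vanishes-qfact n) (ℕ.suc n))

palindromic-qfact : ∀ n → Palindromic (A n) (pdeg n)
palindromic-qfact ℕ.zero (+ ℕ.zero) = refl
palindromic-qfact ℕ.zero (+ ℕ.suc k) = refl
palindromic-qfact ℕ.zero -[1+ k ] = refl
palindromic-qfact (ℕ.suc n) =
  subst (Palindromic (A (ℕ.suc n))) (sym (pdeg-suc n))
        (palindromic-qint (pdeg n) n (qfact n) (vanishes-qfact n) (palindromic-qfact n))

Δ-qfact-suc : ∀ n j → Δ (A (ℕ.suc n)) j ≡ A n j - A n (j - + ℕ.suc n)
Δ-qfact-suc n = Δ-qint (ℕ.suc n) (qfact n)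

-- Floors and ceilings of halves.  The statement writes ⌊d/2⌋ as d / 2 and
-- ⌈d/2⌉ as (d + 1) / 2; we transfer the library facts about ⌊_/2⌋, ⌈_/2⌉.
/2≡⌊/2⌋ : ∀ n → n / 2 ≡ ℕ.⌊ n /2⌋
/2≡⌊/2⌋ ℕ.zero = refl
/2≡⌊/2⌋ (ℕ.suc ℕ.zero) = refl
/2≡⌊/2⌋ (ℕ.suc (ℕ.suc n)) =
  trans (ℕD.m/n≡1+[m∸n]/n {ℕ.suc (ℕ.suc n)} {2} (ℕ.s≤s (ℕ.s≤s ℕ.z≤n))) (cong ℕ.suc (/2≡⌊/2⌋ n))

[+1]/2≡⌈/2⌉ : ∀ n → (n ℕ.+ 1) / 2 ≡ ℕ.⌈ n /2⌉
[+1]/2≡⌈/2⌉ n = trans (cong (_/ 2) (ℕP.+-comm n 1)) (/2≡⌊/2⌋ (ℕ.suc n))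

floor+ceil : ∀ d → d / 2 ℕ.+ (d ℕ.+ 1) / 2 ≡ d
floor+ceil d = trans (cong₂ ℕ._+_ (/2≡⌊/2⌋ d) ([+1]/2≡⌈/2⌉ d)) (ℕP.⌊n/2⌋+⌈n/2⌉≡n d)

floor≤ceil : ∀ d → d / 2 ℕ.≤ (d ℕ.+ 1) / 2
floor≤ceil d rewrite /2≡⌊/2⌋ d | [+1]/2≡⌈/2⌉ d = ℕP.⌊n/2⌋≤⌈n/2⌉ d

ceil≤1+floor : ∀ d → (d ℕ.+ 1) / 2 ℕ.≤ ℕ.suc (d / 2)
ceil≤1+floor d rewrite [+1]/2≡⌈/2⌉ d | /2≡⌊/2⌋ d = ℕP.⌊n/2⌋-mono (ℕP.n≤1+n (ℕ.suc d))

double-floor≤ : ∀ D → D / 2 ℕ.+ D / 2 ℕ.≤ D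
double-floor≤ D = subst (D / 2 ℕ.+ D / 2 ℕ.≤_) (floor+ceil D)
                        (ℕP.+-monoʳ-≤ (D / 2) (floor≤ceil D))

≤1+double-floor : ∀ D → D ℕ.≤ ℕ.suc (D / 2 ℕ.+ D / 2)
≤1+double-floor D = subst (ℕ._≤ ℕ.suc (D / 2 ℕ.+ D / 2)) (floor+ceil D)
  (subst (D / 2 ℕ.+ (D ℕ.+ 1) / 2 ℕ.≤_) (ℕP.+-suc (D / 2) (D / 2))
         (ℕP.+-monoʳ-≤ (D / 2) (ceil≤1+floor D)))

guard-true : ∀ {P Q : Set} (x : ℤ) → Q → (¬ P → x ≡ + 0) → (p : Dec P) (q : Dec Q) →
  (if ⌊ p ⌋ ∧ ⌊ q ⌋ then x else + 0) ≡ x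
guard-true x _ _ (yes _) (yes _) = refl
guard-true x q _ (yes _) (no ¬q) = contradiction q ¬q
guard-true x _ ¬P⇒0 (no ¬p) _ = sym (¬P⇒0 ¬p)

guard-false : ∀ {P Q : Set} (x : ℤ) → ¬ Q → (p : Dec P) (q : Dec Q) →
  (if ⌊ p ⌋ ∧ ⌊ q ⌋ then x else + 0) ≡ + 0
guard-false x ¬q (yes _) (yes q) = contradiction q ¬q
guard-false x _ (yes _) (no _) = refl
guard-false x _ (no _) _ = refl

g-below : ∀ n j → j ≤ + (pdeg n / 2) → g n j ≡ Δ (A n) j
g-below n j j≤H = guard-true (Δ (A n) j) j≤H (negative j) (+ 0 ≤? j) (j ≤? + (pdeg n / 2))
  where
  negative : ∀ j → ¬ (+ 0 ≤ j) → Δ (A n) j ≡ + 0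
  negative (+ k) 0≰k = contradiction (+≤+ ℕ.z≤n) 0≰k
  negative -[1+ k ] _ = refl

g-above : ∀ n j → + (pdeg n / 2) < j → g n j ≡ + 0
g-above n j H<j = guard-false (Δ (A n) j) (ℤP.<⇒≱ H<j) (+ 0 ≤? j) (j ≤? + (pdeg n / 2))

-- By palindromy the difference formula persists up to ⌈d/2⌉: when d is odd,
-- the extra exponent (d+1)/2 carries the difference A n (d+1)/2 - A n (d-1)/2 = 0.
g-below-ceiling : ∀ n j → j ≤ + ((pdeg n ℕ.+ 1) / 2) → g n j ≡ Δ (A n) j
g-below-ceiling n j j≤C = by-cases (j ≤? + H)
  where
  H = pdeg n / 2
  C = (pdeg n ℕ.+ 1) / 2
  cancel : ∀ x y → (x + y) - y ≡ x
  cancel = solve-∀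
  by-cases : Dec (j ≤ + H) → g n j ≡ Δ (A n) j
  by-cases (yes j≤H) = g-below n j j≤H
  by-cases (no j≰H) = begin
    g n j                    ≡⟨ g-above n j (ℤP.≰⇒> j≰H) ⟩
    + 0                      ≡⟨ sym (ℤP.+-inverseʳ (A n j)) ⟩
    A n j - A n j
      ≡⟨ cong (λ x → A n j - x) (trans (sym (palindromic-qfact n j)) (cong (A n) reflected)) ⟩
    Δ (A n) j ∎
    where
    j≡1+H : j ≡ + ℕ.suc H
    j≡1+H = ℤP.≤-antisym (ℤP.≤-trans j≤C (+≤+ (ceil≤1+floor (pdeg n))))
                         (ℤP.i<j⇒suc[i]≤j (ℤP.≰⇒> j≰H))
    d≡H+[1+H] : pdeg n ≡ H ℕ.+ ℕ.suc H
    d≡H+[1+H] = trans (sym (floor+ceil (pdeg n)))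
      (cong (H ℕ.+_) (ℤP.+-injective (ℤP.≤-antisym (+≤+ (ceil≤1+floor (pdeg n)))
                                                   (subst (_≤ + C) j≡1+H j≤C))))
    reflected : + pdeg n - j ≡ j - + 1
    reflected = begin
      + pdeg n - j                   ≡⟨ cong₂ (λ a b → + a - b) d≡H+[1+H] j≡1+H ⟩
      (+ H + + ℕ.suc H) - + ℕ.suc H  ≡⟨ cancel (+ H) (+ ℕ.suc H) ⟩
      + H                            ≡⟨ cong (_- + 1) (sym j≡1+H) ⟩
      j - + 1 ∎

sumFromLen-cong : ∀ (f h : ℤ → ℤ) a k → (∀ t → t ℕ.< k → f (a + + t) ≡ h (a + + t)) →
  sumFromLen a k f ≡ sumFromLen a k h
sumFromLen-cong f h a ℕ.zero _ = refl
sumFromLen-cong f h a (ℕ.suc k) agree = cong₂ _+_ first rest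
  where
  first : f a ≡ h a
  first = subst (λ x → f x ≡ h x) (ℤP.+-identityʳ a) (agree 0 (ℕ.s≤s ℕ.z≤n))
  rest : sumFromLen (a + + 1) k f ≡ sumFromLen (a + + 1) k h
  rest = sumFromLen-cong f h (a + + 1) k λ t t<k →
    subst (λ x → f x ≡ h x) (sym (ℤP.+-assoc a (+ 1) (+ t))) (agree (ℕ.suc t) (ℕ.s≤s t<k))

sumFromLen-Δ : ∀ F a k → sumFromLen a k (Δ F) ≡ F (a + + k - + 1) - F (a - + 1)
sumFromLen-Δ F a ℕ.zero = begin
  + 0                              ≡⟨ sym (ℤP.+-inverseʳ (F (a - + 1))) ⟩
  F (a - + 1) - F (a - + 1)        ≡⟨ cong (λ x → F (x - + 1) - F (a - + 1)) (sym (ℤP.+-identityʳ a)) ⟩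
  F (a + + 0 - + 1) - F (a - + 1)  ∎
sumFromLen-Δ F a (ℕ.suc k) = begin
  Δ F a + sumFromLen (a + + 1) k (Δ F)
    ≡⟨ cong (λ x → Δ F a + x) (sumFromLen-Δ F (a + + 1) k) ⟩
  (F a - F (a - + 1)) + (F (a + + 1 + + k - + 1) - F (a + + 1 - + 1))
    ≡⟨ cong₂ (λ x y → (F a - F (a - + 1)) + (F x - F y)) (reassociate a (+ k)) (cancel a) ⟩
  (F a - F (a - + 1)) + (F (a + + ℕ.suc k - + 1) - F a)
    ≡⟨ telescope₂ (F a) (F (a - + 1)) (F (a + + ℕ.suc k - + 1)) ⟩
  F (a + + ℕ.suc k - + 1) - F (a - + 1) ∎
  where
  reassociate : ∀ a k → a + + 1 + k - + 1 ≡ a + (+ 1 + k) - + 1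
  reassociate = solve-∀
  cancel : ∀ a → a + + 1 - + 1 ≡ a
  cancel = solve-∀
  telescope₂ : ∀ x y z → (x - y) + (z - x) ≡ z - y
  telescope₂ = solve-∀

sumRange-telescope : ∀ (f F : ℤ → ℤ) c → (∀ j → j ≤ c → f j ≡ Δ F j) →
  ∀ a b → a - + 1 ≤ b → b ≤ c → sumRange a b f ≡ F b - F (a - + 1)
sumRange-telescope f F c f≡ΔF a b a-1≤b b≤c = begin
  sumFromLen a k f
    ≡⟨ sumFromLen-cong f (Δ F) a k (λ t t<k → f≡ΔF (a + + t) (ℤP.≤-trans (inside t t<k) b≤c)) ⟩
  sumFromLen a k (Δ F)             ≡⟨ sumFromLen-Δ F a k ⟩
  F (a + + k - + 1) - F (a - + 1)  ≡⟨ cong (λ x → F (x - + 1) - F (a - + 1)) a+k≡1+b ⟩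
  F (+ 1 + b - + 1) - F (a - + 1)  ≡⟨ cong (λ x → F x - F (a - + 1)) (cancel b) ⟩
  F b - F (a - + 1) ∎
  where
  length : ℤ
  length = b + + 1 - a
  k = ∣ length ⊔ + 0 ∣
  rearrange : ∀ a b → b - (a - + 1) ≡ b + + 1 - a
  rearrange = solve-∀
  0≤length : + 0 ≤ length
  0≤length = subst (+ 0 ≤_) (rearrange a b) (ℤP.i≤j⇒0≤j-i a-1≤b)
  +k≡length : + k ≡ length
  +k≡length = trans (cong (λ x → + ∣ x ∣) (ℤP.i≥j⇒i⊔j≡i 0≤length)) (ℤP.0≤i⇒+∣i∣≡i 0≤length)
  complete : ∀ a b → a + (b + + 1 - a) ≡ + 1 + b
  complete = solve-∀
  a+k≡1+b : a + + k ≡ + 1 + b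
  a+k≡1+b = trans (cong (λ x → a + x) +k≡length) (complete a b)
  cancel : ∀ b → + 1 + b - + 1 ≡ b
  cancel = solve-∀
  inside : ∀ t → t ℕ.< k → a + + t ≤ b
  inside t t<k = subst (a + + t ≤_) (ℤP.pred-suc b)
    (ℤP.i<j⇒i≤pred[j] (subst (a + + t <_) a+k≡1+b (ℤP.+-monoʳ-< a (+<+ t<k))))

sumRange-empty : ∀ f a b → b < a → sumRange a b f ≡ + 0
sumRange-empty f a b b<a = cong (λ x → sumFromLen a ∣ x ∣ f) (ℤP.i≤j⇒i⊔j≡j length≤0)
  where
  length≤0 : b + + 1 - a ≤ + 0
  length≤0 = ℤP.i≤j⇒i-j≤0 (subst (_≤ a) (ℤP.+-comm (+ 1) b) (ℤP.i<j⇒suc[i]≤j b<a))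

≤-from-difference : ∀ {x y s} → + 0 ≤ s → y - x ≡ s → x ≤ y
≤-from-difference 0≤s y-x≡s = ℤP.0≤i-j⇒j≤i (subst (+ 0 ≤_) (sym y-x≡s) 0≤s)

g-suc-below : ∀ m i → i ≤ + (pdeg (ℕ.suc m) / 2) →
  g (ℕ.suc m) i ≡ A m i - A m (i - + m - + 1)
g-suc-below m i i≤E = begin
  g (ℕ.suc m) i                ≡⟨ g-below (ℕ.suc m) i i≤E ⟩
  Δ (A (ℕ.suc m)) i            ≡⟨ Δ-qfact-suc m i ⟩
  A m i - A m (i - + ℕ.suc m)  ≡⟨ cong (λ x → A m i - A m x) (shift i (+ m)) ⟩
  A m i - A m (i - + m - + 1)  ∎
  where
  shift : ∀ x y → x - (+ 1 + y) ≡ x - y - + 1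
  shift = solve-∀

window-sum : ∀ m a b → a - + 1 ≤ b → b ≤ + ((pdeg m ℕ.+ 1) / 2) →
  sumRange a b (g m) ≡ A m b - A m (a - + 1)
window-sum m = sumRange-telescope (g m) (A m) _ (g-below-ceiling m)

ceil≤next-floor : ∀ m → 1 ℕ.≤ m → (pdeg m ℕ.+ 1) / 2 ℕ.≤ pdeg (ℕ.suc m) / 2
ceil≤next-floor m m≥1 = subst (λ D → (pdeg m ℕ.+ 1) / 2 ℕ.≤ D / 2) (sym (pdeg-suc m))
                              (ℕD./-monoˡ-≤ 2 (ℕP.+-monoʳ-≤ (pdeg m) m≥1))

recursion-low : ∀ m → 1 ℕ.≤ m → ∀ i → i ≤ + ((pdeg m ℕ.+ 1) / 2) →
  g (ℕ.suc m) i ≡ sumRange (i - + m) i (g m)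
recursion-low m m≥1 i i≤C = begin
  g (ℕ.suc m) i                ≡⟨ g-suc-below m i (ℤP.≤-trans i≤C (+≤+ (ceil≤next-floor m m≥1))) ⟩
  A m i - A m (i - + m - + 1)  ≡⟨ sym (window-sum m (i - + m) i window-nonempty i≤C) ⟩
  sumRange (i - + m) i (g m)   ∎
  where
  window-nonempty : i - + m - + 1 ≤ i
  window-nonempty = ℤP.≤-trans (ℤP.i-j≤i (i - + m) (+ 1)) (ℤP.i-j≤i i (+ m))

-- The second case: i > ⌈binom(m,2)/2⌉.  The window is [i - m, binom(m,2) - i];
-- it is nonempty exactly when i ≤ ⌊binom(m+1,2)/2⌋.
recursion-high : ∀ m i → + ((pdeg m ℕ.+ 1) / 2) < i →
  g (ℕ.suc m) i ≡ sumRange (i - + m) (+ pdeg (ℕ.suc m) - i - + m) (g m)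
recursion-high m i C<i =
  trans (by-cases (i ≤? + E)) (cong (λ b → sumRange (i - + m) b (g m)) (sym upper-limit))
  where
  d = pdeg m
  H = d / 2
  C = (d ℕ.+ 1) / 2
  E = pdeg (ℕ.suc m) / 2
  D≡d+m : + pdeg (ℕ.suc m) ≡ + d + + m
  D≡d+m = cong +_ (pdeg-suc m)
  cancel : ∀ x y → (x + y) - y ≡ x
  cancel = solve-∀
  upper-limit : + pdeg (ℕ.suc m) - i - + m ≡ + d - i
  upper-limit = trans (cong (λ D → D - i - + m) D≡d+m) (drop-m (+ d) (+ m) i)
    where
    drop-m : ∀ d m i → d + m - i - m ≡ d - i
    drop-m = solve-∀
  2E≤d+m : + E + + E ≤ + d + + m
  2E≤d+m = subst (+ E + + E ≤_) D≡d+m (+≤+ (double-floor≤ (pdeg (ℕ.suc m))))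
  d+m≤1+2E : + d + + m ≤ + 1 + (+ E + + E)
  d+m≤1+2E = subst (_≤ + 1 + (+ E + + E)) D≡d+m (+≤+ (≤1+double-floor (pdeg (ℕ.suc m))))
  d-C≡H : + d - + C ≡ + H
  d-C≡H = trans (cong (λ x → + x - + C) (sym (floor+ceil d))) (cancel (+ H) (+ C))
  -- d - i ≤ d - C = ⌊d/2⌋ ≤ ⌈d/2⌉
  d-i≤C : + d - i ≤ + C
  d-i≤C = ℤP.≤-trans (ℤP.+-monoʳ-≤ (+ d) (ℤP.neg-mono-≤ (ℤP.<⇒≤ C<i)))
                     (subst (_≤ + C) (sym d-C≡H) (+≤+ (floor≤ceil d)))
  by-cases : Dec (i ≤ + E) → g (ℕ.suc m) i ≡ sumRange (i - + m) (+ d - i) (g m)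
  by-cases (yes i≤E) = begin
    g (ℕ.suc m) i                      ≡⟨ g-suc-below m i i≤E ⟩
    A m i - A m (i - + m - + 1)        ≡⟨ cong (λ x → x - A m (i - + m - + 1)) (sym (palindromic-qfact m i)) ⟩
    A m (+ d - i) - A m (i - + m - + 1)
      ≡⟨ sym (window-sum m (i - + m) (+ d - i) window-nonempty d-i≤C) ⟩
    sumRange (i - + m) (+ d - i) (g m) ∎
    where
    slack : ∀ d m i E → (d - i) - (i - m - + 1) ≡ ((E - i) + (E - i)) + (((d + m) - (E + E)) + + 1)
    slack = solve-∀
    window-nonempty : i - + m - + 1 ≤ + d - i
    window-nonempty = ≤-from-difference
      (ℤP.+-mono-≤ (ℤP.+-mono-≤ (ℤP.i≤j⇒0≤j-i i≤E) (ℤP.i≤j⇒0≤j-i i≤E))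
                   (ℤP.+-mono-≤ (ℤP.i≤j⇒0≤j-i 2E≤d+m) (+≤+ ℕ.z≤n)))
      (slack (+ d) (+ m) i (+ E))
  by-cases (no i≰E) = begin
    g (ℕ.suc m) i                      ≡⟨ g-above (ℕ.suc m) i (ℤP.≰⇒> i≰E) ⟩
    + 0                                ≡⟨ sym (sumRange-empty (g m) (i - + m) (+ d - i) window-empty) ⟩
    sumRange (i - + m) (+ d - i) (g m) ∎
    where
    slack : ∀ d m i E → (i - m) - (+ 1 + (d - i)) ≡ ((i - (+ 1 + E)) + (i - (+ 1 + E))) + ((+ 1 + (E + E)) - (d + m))
    slack = solve-∀
    1+E≤i : + 1 + + E ≤ i
    1+E≤i = ℤP.i<j⇒suc[i]≤j (ℤP.≰⇒> i≰E)
    window-empty : + d - i < i - + m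
    window-empty = ℤP.suc[i]≤j⇒i<j (≤-from-difference
      (ℤP.+-mono-≤ (ℤP.+-mono-≤ (ℤP.i≤j⇒0≤j-i 1+E≤i) (ℤP.i≤j⇒0≤j-i 1+E≤i))
                   (ℤP.i≤j⇒0≤j-i d+m≤1+2E))
      (slack (+ d) (+ m) i (+ E)))

proposition4p4 : (n : ℕ) → n ≥ 2 → (i : ℤ) →
    (i ≤ + ((pdeg (n ∸ 1) Data.Nat.+ 1) / 2) →
    g n i ≡ sumRange (i - + (n ∸ 1)) i (g (n ∸ 1)))
    ×
    (i > + ((pdeg (n ∸ 1) Data.Nat.+ 1) / 2) →
    g n i ≡ sumRange (i - + (n ∸ 1)) (+ pdeg n - i - + (n ∸ 1)) (g (n ∸ 1)))
proposition4p4 (ℕ.suc m) (ℕ.s≤s m≥1) i = recursion-low m m≥1 i , recursion-high m i
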